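{- Let $\mathcal{L},\mathcal{M}$ be FOLDS-signatures of height $p>0$, $H:\mathcal{L}\to\mathcal{M}$ a discrete opfibration, $L:\mathcal{L}(0)\to\mathcal{U}$, $M:\mathcal{M}(0)\to\mathcal{U}$ and $h:\prod_{K:\mathcal{L}(0)}LK\to M(HK)$. Then the semi-functor $H'_h:\mathcal{L}'_L\to\mathcal{M}'_M$ is a discrete opfibration.
   Context: Two-level type theory (2LTT): outer level with strict equality $\stackrel{\mathrm{s}}{=}$ satisfying uniqueness of identity proofs and function extensionality, strict naturals; inner level homotopy type theory with universes $\mathcal{U}$. A type is fibrant if isomorphic to an inner type, trivially fibrant if isomorphic to a contractible inner type; $B$ is cofibrant if dependent products over $B$ of (trivially) fibrant families are (trivially) fibrant. An inverse semi-category $\mathcal{L}$ of height $p$: types $\mathcal{L}(n)$ ($n<p$), hom-types $\hom_{\mathcal{L}}(K,L)$ for $K:\mathcal{L}(n),L:\mathcal{L}(m)$, $m<n$, strictly associative composition. Fanout $\mathrm{Fan}_m(K):=\sum_{L:\mathcal{L}(m)}\hom_{\mathcal{L}}(K,L)$. A FOLDS-signature: each $\mathcal{L}(n)$ fibrant and each fanout cofibrant. A strict semi-functor preserves ranks and composition strictly and induces maps $\mathrm{Fan}_m(K)\to\mathrm{Fan}_m(HK)$; it is a discrete opfibration if these are isomorphisms, with inverses written $H^{ -1}$. Derivative: for $M:\mathcal{L}(0)\to\mathcal{U}$, $\mathcal{L}'_M$ has height $p-1$, $\mathcal{L}'_M(n):=\sum_{K:\mathcal{L}(n+1)}\prod_{F:\mathrm{Fan}_0(K)}M(\pi_1F)$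 and $\hom_{\mathcal{L}'_M}((K_1,\alpha_1),(K_2,\alpha_2)):=\sum_{f:\hom(K_1,K_2)}\prod_{F:\mathrm{Fan}_0(K_2)}\alpha_1(F\circ f)\stackrel{\mathrm{s}}{=}\alpha_2(F)$ with $(L,g)\circ f:=(L,g\circ f)$. The semi-functor $H'_h$ sends an object $(K,\alpha)$ to $(HK,\beta)$ with $\beta(F):=h_{\pi_1(H^{ -1}F)}(\alpha(H^{ -1}F))$ for $F:\mathrm{Fan}_0(HK)$, and a morphism $(f,\phi)$ to $(Hf,\psi)$ where $\psi$ is the induced family of strict equalities. -}

{-# OPTIONS --with-K #-}
module Defs where

-- Outer level of 2LTT = Agda with axiom K (so ≡ satisfies UIP) and with
-- function extensionality supplied as an explicit hypothesis where needed.
-- Inner level = an abstract universe 𝒰 with decoding El.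

open import Level using (0ℓ)
open import Data.Nat using (ℕ; zero; suc; z≤n; s≤s)
open import Data.Fin using (Fin; zero; suc; _<_)
open import Data.Fin.Properties using (<-trans)
open import Data.Product using (Σ; _×_; _,_; proj₁; proj₂)
open import Function.Bundles using (_↔_)
open import Relation.Binary.PropositionalEquality
open import Axiom.Extensionality.Propositional using (Extensionality)
open import Axiom.UniquenessOfIdentityProofs.WithK using (uip)

record InnerLevel : Set₁ where
  field
    𝒰       : Set
    El      : 𝒰 → Set
    IsContr : 𝒰 → Set

module Fibrancy (I : InnerLevel) where
  open InnerLevel I

  Fibrant : Set → Set
  Fibrant X = Σ 𝒰 λ A → X ↔ El A

  TrivFibrant : Set → Set
  TrivFibrant X = Σ 𝒰 λ A → IsContr A × (X ↔ El A)

  Cofibrant : Set → Set₁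
  Cofibrant B =
      ((Y : B → Set) → ((b : B) → Fibrant (Y b)) → Fibrant ((b : B) → Y b))
    × ((Y : B → Set) → ((b : B) → TrivFibrant (Y b)) → TrivFibrant ((b : B) → Y b))

record InvSemiCat (p : ℕ) : Set₁ where
  infixr 9 _∘_
  field
    Ob    : Fin p → Set
    Hom   : {n m : Fin p} → .(m < n) → Ob n → Ob m → Set
    _∘_   : {n m k : Fin p} .{mn : m < n} .{km : k < m}
            {K : Ob n} {L : Ob m} {N : Ob k} →
            Hom km L N → Hom mn K L → Hom (<-trans km mn) K N
    assoc : {n m k j : Fin p} .{mn : m < n} .{km : k < m} .{jk : j < k}
            {K : Ob n} {L : Ob m} {N : Ob k} {P : Ob j}
            (h : Hom jk N P) (g : Hom km L N) (f : Hom mn K L) →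
            (h ∘ g) ∘ f ≡ h ∘ (g ∘ f)

  Fan : {n : Fin p} (m : Fin p) .(mn : m < n) → Ob n → Set
  Fan m mn K = Σ (Ob m) λ L → Hom mn K L

  _∘F_ : {n n' m : Fin p} .{mn : m < n} .{nn' : n < n'}
         {K' : Ob n'} {K : Ob n} → Fan m mn K → Hom nn' K' K →
         Fan m (<-trans mn nn') K'
  (L , g) ∘F f = L , g ∘ f

open InvSemiCat

module _ {p : ℕ} (I : InnerLevel) where
  open Fibrancy I

  IsFOLDS : InvSemiCat p → Set₁
  IsFOLDS 𝓛 =
      ((n : Fin p) → Fibrant (Ob 𝓛 n))
    × ({n : Fin p} (m : Fin p) .(mn : m < n) (K : Ob 𝓛 n) → Cofibrant (Fan 𝓛 m mn K))

record SemiFunctor {p : ℕ} (𝓛 𝓜 : InvSemiCat p) : Set where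
  field
    F₀     : {n : Fin p} → Ob 𝓛 n → Ob 𝓜 n
    F₁     : {n m : Fin p} .{mn : m < n} {K : Ob 𝓛 n} {L : Ob 𝓛 m} →
             Hom 𝓛 mn K L → Hom 𝓜 mn (F₀ K) (F₀ L)
    F-comp : {n m k : Fin p} .{mn : m < n} .{km : k < m}
             {K : Ob 𝓛 n} {L : Ob 𝓛 m} {N : Ob 𝓛 k}
             (g : Hom 𝓛 km L N) (f : Hom 𝓛 mn K L) →
             F₁ (_∘_ 𝓛 g f) ≡ _∘_ 𝓜 (F₁ g) (F₁ f)

  FanMap : {n : Fin p} (m : Fin p) .(mn : m < n) (K : Ob 𝓛 n) →
           Fan 𝓛 m mn K → Fan 𝓜 m mn (F₀ K)
  FanMap m mn K (L , f) = F₀ L , F₁ f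

record IsIso {A B : Set} (f : A → B) : Set where
  field
    inv     : B → A
    inv-f   : (x : A) → inv (f x) ≡ x
    f-inv   : (y : B) → f (inv y) ≡ y

IsDiscreteOpfibration : {p : ℕ} {𝓛 𝓜 : InvSemiCat p} → SemiFunctor 𝓛 𝓜 → Set
IsDiscreteOpfibration {p} {𝓛} H =
  {n : Fin p} (m : Fin p) .(mn : m < n) (K : Ob 𝓛 n) →
  IsIso (SemiFunctor.FanMap H m mn K)

z<s : {q : ℕ} (n : Fin q) → _<_ {suc q} zero (suc n)
z<s n = s≤s z≤n

module Derivative (fe : Extensionality 0ℓ 0ℓ) (I : InnerLevel) {q : ℕ}
                  (𝓛 : InvSemiCat (suc q)) (M : Ob 𝓛 zero → InnerLevel.𝒰 I) where
  open InnerLevel I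
  private
    module L = InvSemiCat 𝓛

  Ob' : Fin q → Set
  Ob' n = Σ (L.Ob (suc n)) λ K → (F : L.Fan zero (z<s n) K) → El (M (proj₁ F))

  Hom' : {n m : Fin q} → .(m < n) → Ob' n → Ob' m → Set
  Hom' {n} {m} mn K L =
    Σ (L.Hom {suc n} {suc m} (s≤s mn) (proj₁ K) (proj₁ L)) λ f →
      (F : L.Fan zero (z<s m) (proj₁ L)) → proj₂ K (F L.∘F f) ≡ proj₂ L F

  private
    apd-α : {n : Fin q} {K : L.Ob (suc n)}
            (α : (F : L.Fan zero (z<s n) K) → El (M (proj₁ F)))
            {F G : L.Fan zero (z<s n) K} (e : F ≡ G) →
            subst (λ X → El (M X)) (cong proj₁ e) (α F) ≡ α G
    apd-α α refl = refl

    sub-irr : {a b : Ob 𝓛 zero} (e e' : a ≡ b) (x : El (M a)) →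
              subst (λ X → El (M X)) e x ≡ subst (λ X → El (M X)) e' x
    sub-irr e e' x rewrite uip e e' = refl

    fan-eq : {n : Fin q} {K : L.Ob (suc n)} {F G : L.Fan zero (z<s n) K} →
             F ≡ G → proj₁ F ≡ proj₁ G
    fan-eq = cong proj₁

  comp' : {n m k : Fin q} .{mn : m < n} .{km : k < m}
          {K : Ob' n} {L : Ob' m} {N : Ob' k} →
          Hom' km L N → Hom' mn K L → Hom' (<-trans km mn) K N
  comp' {K = K} (g , ψ) (f , φ) =
    L._∘_ g f , λ F →
      trans (sym (trans (sym (sub-irr (fan-eq (e F)) refl (proj₂ K ((F L.∘F g) L.∘F f))))
                        (apd-α (proj₂ K) (e F))))
            (trans (φ (F L.∘F g)) (ψ F))
    where
    e : ∀ F → (F L.∘F g) L.∘F f ≡ F L.∘F (L._∘_ g f)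
    e (P , h) = cong (P ,_) (L.assoc h g f)

  private
    Hom'-≡ : {n m : Fin q} .{mn : m < n} {K : Ob' n} {L : Ob' m}
             (x y : Hom' mn K L) → proj₁ x ≡ proj₁ y → x ≡ y
    Hom'-≡ (f , φ) (.f , ψ) refl = cong (f ,_) (fe λ F → uip (φ F) (ψ F))

  assoc' : {n m k j : Fin q} .{mn : m < n} .{km : k < m} .{jk : j < k}
           {K : Ob' n} {L : Ob' m} {N : Ob' k} {P : Ob' j}
           (h : Hom' jk N P) (g : Hom' km L N) (f : Hom' mn K L) →
           comp' {mn = mn} {km = <-trans jk km} {K = K} {L = L} {N = P}
                 (comp' {mn = km} {km = jk} {K = L} {L = N} {N = P} h g) f
           ≡ comp' {mn = <-trans km mn} {km = jk} {K = K} {L = N} {N = P}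
                 h (comp' {mn = mn} {km = km} {K = K} {L = L} {N = N} g f)
  assoc' {mn = mn} {km} {jk} {K = K} {L} {N} {P} h g f =
    Hom'-≡ {mn = <-trans (<-trans jk km) mn} {K = K} {L = P} _ _ (L.assoc (proj₁ h) (proj₁ g) (proj₁ f))

  derivative : InvSemiCat q
  derivative = record
    { Ob = Ob'
    ; Hom = Hom'
    ; _∘_ = λ {n} {m} {k} {mn} {km} {K} {L} {N} → comp' {mn = mn} {km = km} {K = K} {L = L} {N = N}
    ; assoc = λ {n} {m} {k} {j} {mn} {km} {jk} {K} {L} {N} {P} →
        assoc' {mn = mn} {km = km} {jk = jk} {K = K} {L = L} {N = N} {P = P}
    }

module InducedFunctor (fe : Extensionality 0ℓ 0ℓ) (I : InnerLevel) {q : ℕ}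
         {𝓛 𝓜 : InvSemiCat (suc q)}
         (H : SemiFunctor 𝓛 𝓜) (dof : IsDiscreteOpfibration H)
         (Lf : Ob 𝓛 zero → InnerLevel.𝒰 I) (Mf : Ob 𝓜 zero → InnerLevel.𝒰 I)
         (h : (K : Ob 𝓛 zero) → InnerLevel.El I (Lf K) → InnerLevel.El I (Mf (SemiFunctor.F₀ H K)))
         where
  open InnerLevel I
  open SemiFunctor H
  private
    module L = InvSemiCat 𝓛
    module M = InvSemiCat 𝓜
    module L' = Derivative fe I 𝓛 Lf
    module M' = Derivative fe I 𝓜 Mf

    H⁻¹ : {n : Fin q} (K : L.Ob (suc n)) → M.Fan zero (z<s n) (F₀ K) → L.Fan zero (z<s n) K
    H⁻¹ K = IsIso.inv (dof zero (z<s _) K)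

    H-H⁻¹ : {n : Fin q} (K : L.Ob (suc n)) (F : M.Fan zero (z<s n) (F₀ K)) →
            FanMap zero (z<s n) K (H⁻¹ K F) ≡ F
    H-H⁻¹ K = IsIso.f-inv (dof zero (z<s _) K)

    H⁻¹-H : {n : Fin q} (K : L.Ob (suc n)) (F : L.Fan zero (z<s n) K) →
            H⁻¹ K (FanMap zero (z<s n) K F) ≡ F
    H⁻¹-H K = IsIso.inv-f (dof zero (z<s _) K)

  H'₀ : {n : Fin q} → L'.Ob' n → M'.Ob' n
  H'₀ Kα = F₀ (proj₁ Kα) , λ F →
    subst (λ X → El (Mf X)) (cong proj₁ (H-H⁻¹ (proj₁ Kα) F))
          (h (proj₁ (H⁻¹ (proj₁ Kα) F)) (proj₂ Kα (H⁻¹ (proj₁ Kα) F)))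

  private
    key : {a b : L.Ob zero} {c : M.Ob zero} (p : F₀ a ≡ c) (p' : F₀ b ≡ c)
          (r : a ≡ b) (u : El (Lf a)) (v : El (Lf b)) →
          subst (λ X → El (Lf X)) r u ≡ v →
          subst (λ X → El (Mf X)) p (h a u) ≡ subst (λ X → El (Mf X)) p' (h b v)
    key refl refl refl u .u refl = refl

    apd-α : {n : Fin q} {K : L.Ob (suc n)}
            (α : (F : L.Fan zero (z<s n) K) → El (Lf (proj₁ F)))
            {F G : L.Fan zero (z<s n) K} (e : F ≡ G) →
            subst (λ X → El (Lf X)) (cong proj₁ e) (α F) ≡ α G
    apd-α α refl = refl

    fanmap-comp : {n m : Fin q} .{mn : m < n} {K₁ : L.Ob (suc n)} {K₂ : L.Ob (suc m)}
                  (f : L.Hom (s≤s mn) K₁ K₂) (G : L.Fan zero (z<s m) K₂) →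
                  FanMap zero (z<s n) K₁ (G L.∘F f) ≡ (FanMap zero (z<s m) K₂ G) M.∘F F₁ f
    fanmap-comp f (P , g) = cong (F₀ P ,_) (F-comp g f)

  H'₁ : {n m : Fin q} .{mn : m < n} {K : L'.Ob' n} {L : L'.Ob' m} →
        L'.Hom' mn K L → M'.Hom' mn (H'₀ K) (H'₀ L)
  H'₁ {mn = mn} {K = K₁ , α₁} {L = K₂ , α₂} (f , φ) = F₁ f , λ F →
    key (cong proj₁ (H-H⁻¹ K₁ (F M.∘F F₁ f))) (cong proj₁ (H-H⁻¹ K₂ F))
        (cong proj₁ (E F)) _ _
        (trans (apd-α α₁ (E F)) (φ (H⁻¹ K₂ F)))
    where
    E : ∀ F → H⁻¹ K₁ (F M.∘F F₁ {mn = s≤s mn} f) ≡ H⁻¹ K₂ F L.∘F f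
    E F = trans (cong (λ G → H⁻¹ K₁ (G M.∘F F₁ f)) (sym (H-H⁻¹ K₂ F)))
                (trans (cong (H⁻¹ K₁) (sym (fanmap-comp {mn = mn} f (H⁻¹ K₂ F))))
                       (H⁻¹-H K₁ (H⁻¹ K₂ F L.∘F f)))

  private
    Hom'-≡ : {n m : Fin q} .{mn : m < n} {K : M'.Ob' n} {L : M'.Ob' m}
             (x y : M'.Hom' mn K L) → proj₁ x ≡ proj₁ y → x ≡ y
    Hom'-≡ (f , φ) (.f , ψ) refl = cong (f ,_) (fe λ F → uip (φ F) (ψ F))

  H' : SemiFunctor (Derivative.derivative fe I 𝓛 Lf) (Derivative.derivative fe I 𝓜 Mf)
  H' = record
    { F₀ = H'₀
    ; F₁ = λ {n} {m} {mn} {K} {L} → H'₁ {mn = mn} {K = K} {L = L}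
    ; F-comp = λ {n} {m} {k} {mn} {km} {K} {L} {N} → Hcomp {mn = mn} {km = km} {K = K} {L = L} {N = N}
    }
    where
    Hcomp : {n m k : Fin q} .{mn : m < n} .{km : k < m}
            {K : L'.Ob' n} {L : L'.Ob' m} {N : L'.Ob' k}
            (g : L'.Hom' km L N) (f : L'.Hom' mn K L) →
            H'₁ {mn = <-trans km mn} {K = K} {L = N} (L'.comp' {mn = mn} {km = km} {K = K} {L = L} {N = N} g f)
            ≡ M'.comp' {mn = mn} {km = km} {K = H'₀ K} {L = H'₀ L} {N = H'₀ N}
                (H'₁ {mn = km} {K = L} {L = N} g) (H'₁ {mn = mn} {K = K} {L = L} f)
    Hcomp {mn = mn} {km} {K = K} {L} {N} g f = Hom'-≡ {mn = <-trans km mn} {K = H'₀ K} {L = H'₀ N} _ _ (F-comp (proj₁ g) (proj₁ f))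

module Submission where

-- In a derivative 𝓛'_M a fanout ((K₂ , β) , (f , ψ)) of an
-- object (K , α) is determined by its underlying fanout (K₂ , f) of K:
-- the equations ψ force β(G) = α(G ∘ f), and by UIP and function
-- extensionality ψ itself is unique.  Hence forgetting the decorations is an
-- isomorphism  Fan_m(K , α) ≅ Fan_{m+1}(K)  (lemma fanout-iso).
--
-- The fanout map of H'_h, followed by this forgetful isomorphism on 𝓜'_M,
-- is literally the fanout map of H preceded by the forgetful isomorphism on
-- 𝓛'_L.  The fanout map of H is an isomorphism because H is a discrete
-- opfibration, and a map conjugate to an isomorphism by isomorphisms is an
-- isomorphism (lemma iso-conjugate); this gives the theorem.

open import Defs
open import Level using (0ℓ)
open import Data.Nat using (ℕ; suc; s≤s)
open import Data.Fin using (Fin; zero; suc; _<_)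
open import Data.Product using (Σ; _,_; proj₁; proj₂)
open import Relation.Binary.PropositionalEquality
open import Axiom.Extensionality.Propositional using (Extensionality)
open import Axiom.UniquenessOfIdentityProofs.WithK using (uip)

iso-injective : {A B : Set} {f : A → B} → IsIso f → {x y : A} → f x ≡ f y → x ≡ y
iso-injective {f = f} iso {x} {y} e = begin
  x                   ≡⟨ sym (IsIso.inv-f iso x) ⟩
  IsIso.inv iso (f x) ≡⟨ cong (IsIso.inv iso) e ⟩
  IsIso.inv iso (f y) ≡⟨ IsIso.inv-f iso y ⟩
  y                   ∎
  where open ≡-Reasoning

iso-conjugate : {A B A' B' : Set} (f : A → B) (g : A' → B') (rA : A → A') (rB : B → B') →
                IsIso rA → IsIso rB → (∀ x → rB (f x) ≡ g (rA x)) → IsIso g → IsIso f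
iso-conjugate {A} {B} f g rA rB isoA isoB square isoG = record
  { inv   = f⁻¹
  ; inv-f = λ x → begin
      f⁻¹ (f x)                                    ≡⟨ cong (λ b → IsIso.inv isoA (IsIso.inv isoG b)) (square x) ⟩
      IsIso.inv isoA (IsIso.inv isoG (g (rA x)))   ≡⟨ cong (IsIso.inv isoA) (IsIso.inv-f isoG (rA x)) ⟩
      IsIso.inv isoA (rA x)                        ≡⟨ IsIso.inv-f isoA x ⟩
      x                                            ∎
  ; f-inv = λ y → iso-injective isoB (begin
      rB (f (f⁻¹ y))                                  ≡⟨ square (f⁻¹ y) ⟩
      g (rA (IsIso.inv isoA (IsIso.inv isoG (rB y)))) ≡⟨ cong g (IsIso.f-inv isoA (IsIso.inv isoG (rB y))) ⟩
      g (IsIso.inv isoG (rB y))                       ≡⟨ IsIso.f-inv isoG (rB y) ⟩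
      rB y                                            ∎)
  }
  where
  open ≡-Reasoning
  f⁻¹ : B → A
  f⁻¹ b = IsIso.inv isoA (IsIso.inv isoG (rB b))

module DerivativeFanouts (fe : Extensionality 0ℓ 0ℓ) (I : InnerLevel) {q : ℕ}
         (𝓒 : InvSemiCat (suc q)) (C : InvSemiCat.Ob 𝓒 zero → InnerLevel.𝒰 I) where
  open InnerLevel I
  private
    module 𝓒 = InvSemiCat 𝓒
    module 𝓒' = Derivative fe I 𝓒 C
    𝓒'' : InvSemiCat q
    𝓒'' = 𝓒'.derivative

  forget : {n m : Fin q} .(mn : m < n) (Kα : 𝓒'.Ob' n) →
           InvSemiCat.Fan 𝓒'' m mn Kα → 𝓒.Fan (suc m) (s≤s mn) (proj₁ Kα)
  forget mn Kα ((K₂ , _) , (f , _)) = K₂ , f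

  decorate : {n m : Fin q} .(mn : m < n) (Kα : 𝓒'.Ob' n) →
             𝓒.Fan (suc m) (s≤s mn) (proj₁ Kα) → InvSemiCat.Fan 𝓒'' m mn Kα
  decorate mn (K , α) (K₂ , f) = (K₂ , λ G → α (G 𝓒.∘F f)) , (f , λ G → refl)

  -- A decorated fanout equals the canonical decoration of its underlying
  -- fanout: β is forced pointwise by ψ, and the equations ψ are unique by UIP.
  decorate-forget : {n m : Fin q} .(mn : m < n) (Kα : 𝓒'.Ob' n)
                    (x : InvSemiCat.Fan 𝓒'' m mn Kα) → decorate mn Kα (forget mn Kα x) ≡ x
  decorate-forget {m = m} mn (K , α) ((K₂ , _) , (f , ψ)) =
    same-decoration (fe ψ) (λ G → refl) ψ
    where
    same-decoration : {β₁ β₂ : (G : 𝓒.Fan zero (z<s m) K₂) → El (C (proj₁ G))} → β₁ ≡ β₂ →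
                      (ψ₁ : ∀ G → α (G 𝓒.∘F f) ≡ β₁ G) (ψ₂ : ∀ G → α (G 𝓒.∘F f) ≡ β₂ G) →
                      _≡_ {A = InvSemiCat.Fan 𝓒'' m mn (K , α)}
                          ((K₂ , β₁) , (f , ψ₁)) ((K₂ , β₂) , (f , ψ₂))
    same-decoration {β₁} refl ψ₁ ψ₂ =
      cong (λ ψ' → (K₂ , β₁) , (f , ψ')) (fe λ G → uip (ψ₁ G) (ψ₂ G))

  fanout-iso : {n m : Fin q} .(mn : m < n) (Kα : 𝓒'.Ob' n) → IsIso (forget mn Kα)
  fanout-iso mn Kα = record
    { inv   = decorate mn Kα
    ; inv-f = decorate-forget mn Kα
    ; f-inv = λ _ → refl
    }

propositionA18 : (fe : Extensionality 0ℓ 0ℓ) (I : InnerLevel) {q : ℕ}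
    (𝓛 𝓜 : InvSemiCat (suc q)) → IsFOLDS I 𝓛 → IsFOLDS I 𝓜 →
    (H : SemiFunctor 𝓛 𝓜) (dof : IsDiscreteOpfibration H)
    (L : InvSemiCat.Ob 𝓛 zero → InnerLevel.𝒰 I)
    (M : InvSemiCat.Ob 𝓜 zero → InnerLevel.𝒰 I)
    (h : (K : InvSemiCat.Ob 𝓛 zero) → InnerLevel.El I (L K) →
    InnerLevel.El I (M (SemiFunctor.F₀ H K))) →
    IsDiscreteOpfibration (InducedFunctor.H' fe I H dof L M h)
propositionA18 fe I 𝓛 𝓜 _ _ H dof L M h m mn Kα =
  iso-conjugate (SemiFunctor.FanMap H'h m mn Kα) (SemiFunctor.FanMap H (suc m) (s≤s mn) (proj₁ Kα))
                (𝓛'.forget mn Kα) (𝓜'.forget mn (SemiFunctor.F₀ H'h Kα))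
                (𝓛'.fanout-iso mn Kα) (𝓜'.fanout-iso mn (SemiFunctor.F₀ H'h Kα))
                (λ _ → refl) (dof (suc m) (s≤s mn) (proj₁ Kα))
  where
  H'h : SemiFunctor (Derivative.derivative fe I 𝓛 L) (Derivative.derivative fe I 𝓜 M)
  H'h = InducedFunctor.H' fe I H dof L M h
  module 𝓛' = DerivativeFanouts fe I 𝓛 L
  module 𝓜' = DerivativeFanouts fe I 𝓜 M
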